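{- If a layer-latin parallelepiped of size $2\times5\times2$ contains two nonadjacent $2$-cubes with no transversals, then every other $2$-cube of the parallelepiped has transversals with at least $3$ different ranges.
   Context: $Q_5=\{0,\dots,4\}$. A layer-latin parallelepiped of size $2\times5\times2$ is a pair of $2\times5$ arrays (layers) over $Q_5$ such that in each layer every row contains $5$ distinct symbols and every column contains $2$ distinct symbols. A $2$-cube of the parallelepiped is the $2\times2\times2$ array obtained by keeping the same two column positions in both layers; two distinct $2$-cubes are adjacent if they share a column position. A diagonal of a $2$-cube is a pair of its cells differing in all three coordinates (layer, row, column); a transversal is a diagonal whose two cells have different symbols, and its range is the set of these two symbols. -}

module Defs where

open import Data.Fin using (Fin; zero; suc)
open import Data.Product using (_×_; Σ-syntax)
open import Data.Sum using (_⊎_)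
open import Relation.Binary.PropositionalEquality using (_≡_; _≢_)
open import Relation.Nullary using (¬_)

-- Symbols: Q_5 = Fin 5.
-- A 2×5×2 parallelepiped: P layer row column, layers/rows in Fin 2, columns in Fin 5.
Parallelepiped : Set
Parallelepiped = Fin 2 → Fin 2 → Fin 5 → Fin 5

IsLayerLatin : Parallelepiped → Set
IsLayerLatin P =
  (∀ (l r : Fin 2) (c c′ : Fin 5) → c ≢ c′ → P l r c ≢ P l r c′) ×
  (∀ (l : Fin 2) (c : Fin 5) → P l zero c ≢ P l (suc zero) c)

flip : Fin 2 → Fin 2
flip zero = suc zero
flip (suc _) = zero

-- A 2-cube is determined by two distinct columns i ≠ j.  Its four diagonals
-- are indexed by (l , r) : the cells (l , r , i) and (flip l , flip r , j).
diag₁ : Parallelepiped → Fin 5 → Fin 5 → Fin 2 → Fin 2 → Fin 5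
diag₁ P i j l r = P l r i

diag₂ : Parallelepiped → Fin 5 → Fin 5 → Fin 2 → Fin 2 → Fin 5
diag₂ P i j l r = P (flip l) (flip r) j

IsTransversal : Parallelepiped → Fin 5 → Fin 5 → Fin 2 → Fin 2 → Set
IsTransversal P i j l r = diag₁ P i j l r ≢ diag₂ P i j l r

NoTransversals : Parallelepiped → Fin 5 → Fin 5 → Set
NoTransversals P i j = ∀ (l r : Fin 2) → ¬ IsTransversal P i j l r

SameSet : Fin 5 → Fin 5 → Fin 5 → Fin 5 → Set
SameSet a b c d = (a ≡ c × b ≡ d) ⊎ (a ≡ d × b ≡ c)

SameRange : Parallelepiped → Fin 5 → Fin 5 → Fin 2 → Fin 2 → Fin 2 → Fin 2 → Set
SameRange P i j l r l′ r′ =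
  SameSet (diag₁ P i j l r) (diag₂ P i j l r) (diag₁ P i j l′ r′) (diag₂ P i j l′ r′)

AtLeastThreeRanges : Parallelepiped → Fin 5 → Fin 5 → Set
AtLeastThreeRanges P i j =
  Σ[ l₁ ∈ Fin 2 ] Σ[ r₁ ∈ Fin 2 ] Σ[ l₂ ∈ Fin 2 ] Σ[ r₂ ∈ Fin 2 ] Σ[ l₃ ∈ Fin 2 ] Σ[ r₃ ∈ Fin 2 ]
    (IsTransversal P i j l₁ r₁ × IsTransversal P i j l₂ r₂ × IsTransversal P i j l₃ r₃ ×
     ¬ SameRange P i j l₁ r₁ l₂ r₂ × ¬ SameRange P i j l₁ r₁ l₃ r₃ × ¬ SameRange P i j l₂ r₂ l₃ r₃)

SameCube : Fin 5 → Fin 5 → Fin 5 → Fin 5 → Set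
SameCube i j k m = SameSet i j k m

Nonadjacent : Fin 5 → Fin 5 → Fin 5 → Fin 5 → Set
Nonadjacent i j k m = i ≢ k × i ≢ m × j ≢ k × j ≢ m

-- A 2-cube on columns {x, y} without transversals says that the second layer agrees on
-- these columns with the first layer, rows swapped and columns x, y exchanged. Since rows
-- are permutations, two such disjoint cubes {i, j}, {k, m} force the same on the fifth
-- column: the second layer is the first with rows swapped and columns permuted by
-- σ = (i j)(k m). If f, g are the rows of the first layer, the diagonals (0,0), (1,1),
-- (0,1), (1,0) of any other cube {a, b} then have ranges f{a, σb}, f{σa, b}, g{a, σb},
-- g{σa, b}, all of them transversals. Having only two ranges would make f map the set
-- {a, σa, b, σb} into its image under g; when it has four elements, f and g then agree
-- on the remaining column, which the latin property forbids, and otherwise a and b are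
-- both fixed by σ, which fixes only one column.
module Submission where

open import Defs
open import Data.Fin using (Fin)
open import Relation.Binary.PropositionalEquality using (_≢_)
open import Relation.Nullary using (¬_)

open import Data.Fin.Patterns using (0F; 1F)
open import Data.Fin.Permutation.Components using (transpose)
open import Data.Fin.Properties using (_≟_; any?; injective⇒≤)
open import Data.Nat using (suc)
open import Data.Nat.Properties using (1+n≰n)
open import Data.Product using (∃; _×_; _,_; proj₂)
open import Data.Sum using (_⊎_; inj₁; inj₂; [_,_])
open import Data.Vec using (Vec; []; _∷_; map; lookup)
open import Data.Vec.Membership.Propositional using (_∈_; _∉_)
open import Data.Vec.Membership.Propositional.Properties using (∈-map⁺; ∈-++⁺ˡ; ∈-++⁺ʳ; fromAny)
open import Data.Vec.Relation.Unary.All using (All; []; _∷_)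
open import Data.Vec.Relation.Unary.AllPairs using ([]; _∷_)
import Data.Vec.Relation.Unary.Any as Any
open Any using (here; there)
open import Data.Vec.Relation.Unary.Any.Properties using (lookup-index; ++⁻)
  renaming (map⁻ to Any-map⁻)
open import Data.Vec.Relation.Unary.Unique.Propositional using (Unique)
open import Data.Vec.Relation.Unary.Unique.Propositional.Properties using (lookup-injective; map⁺)
open import Function using (_∘_)
open import Function.Definitions using (Injective)
open import Relation.Binary.PropositionalEquality using (_≡_; refl; sym; trans; cong; subst)
open import Relation.Nullary using (Dec; yes; no; ¬?; contradiction)
open import Relation.Nullary.Decidable using (dec-true; dec-false; decidable-stable; _×-dec_; _⊎-dec_)

∉⇒All≢ : ∀ {a} {A : Set a} {n} {w : A} {xs : Vec A n} → w ∉ xs → All (w ≢_) xs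
∉⇒All≢ {xs = []}     _    = []
∉⇒All≢ {xs = _ ∷ _} w∉xs = w∉xs ∘ here ∷ ∉⇒All≢ (w∉xs ∘ there)

_∈?_ : ∀ {n k} (x : Fin n) (xs : Vec (Fin n) k) → Dec (x ∈ xs)
x ∈? xs = Any.any? (x ≟_) xs

unique⇒complete : ∀ {n} {xs : Vec (Fin n) n} → Unique xs → ∀ y → y ∈ xs
unique⇒complete {xs = xs} xs-unique y with y ∈? xs
... | yes y∈xs = y∈xs
... | no  y∉xs = contradiction (injective⇒≤ λ {p} {q} → lookup-injective (∉⇒All≢ y∉xs ∷ xs-unique) p q) 1+n≰n

∃-∉ : ∀ {n} (xs : Vec (Fin (suc n)) n) → ∃ λ w → w ∉ xs
∃-∉ xs with any? (λ w → ¬? (w ∈? xs))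
... | yes w∉xs = w∉xs
... | no  none = contradiction (injective⇒≤ index-injective) 1+n≰n
  where
  covered : ∀ w → w ∈ xs
  covered w = decidable-stable (w ∈? xs) (none ∘ (w ,_))

  index-injective : Injective _≡_ _≡_ (Any.index ∘ covered)
  index-injective {v} {w} eq =
    trans (lookup-index (covered v)) (trans (cong (lookup xs) eq) (sym (lookup-index (covered w))))

∉-unique : ∀ {n} {xs : Vec (Fin (suc n)) n} → Unique xs → ∀ {u v} → u ∉ xs → v ∉ xs → u ≡ v
∉-unique xs-unique {v = v} u∉xs v∉xs with unique⇒complete (∉⇒All≢ u∉xs ∷ xs-unique) v
... | here v≡u     = sym v≡u
... | there v∈xs = contradiction v∈xs v∉xs

-- g w is f x for some x by counting; x ∈ xs is impossible since f x ∈ g[xs] and g is injective.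
image⊆⇒agree-outside : ∀ {n} {f g : Fin (suc n) → Fin (suc n)} {xs : Vec (Fin (suc n)) n} {w} →
  Injective _≡_ _≡_ f → Injective _≡_ _≡_ g → Unique xs → w ∉ xs →
  (∀ {x} → x ∈ xs → f x ∈ map g xs) → f w ≡ g w
image⊆⇒agree-outside {f = f} {g} {xs} {w} f-inj g-inj xs-unique w∉xs f[xs]⊆g[xs]
  with Any-map⁻ (unique⇒complete (map⁺ f-inj (∉⇒All≢ w∉xs ∷ xs-unique)) (g w))
... | here gw≡fw = sym gw≡fw
... | there gw∈f[xs] =
  let (x , x∈xs , gw≡fx) = fromAny gw∈f[xs]
      (y , y∈xs , fx≡gy) = fromAny (Any-map⁻ (f[xs]⊆g[xs] x∈xs))
  in  contradiction (subst (_∈ xs) (sym (g-inj (trans gw≡fx fx≡gy))) y∈xs) w∉xs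

transpose-matchˡ : ∀ {n} (i j : Fin n) → transpose i j i ≡ j
transpose-matchˡ i j rewrite dec-true (i ≟ i) refl = refl

transpose-matchʳ : ∀ {n} (i j : Fin n) → transpose i j j ≡ i
transpose-matchʳ i j with j ≟ i
... | yes j≡i = j≡i
... | no  _   rewrite dec-true (j ≟ j) refl = refl

transpose-mismatch : ∀ {n} {i j x : Fin n} → x ≢ i → x ≢ j → transpose i j x ≡ x
transpose-mismatch {i = i} {j} {x} x≢i x≢j
  rewrite dec-false (x ≟ i) x≢i | dec-false (x ≟ j) x≢j = refl

module DoubleTransposition {i j k m : Fin 5}
  (i≢j : i ≢ j) (i≢k : i ≢ k) (i≢m : i ≢ m) (j≢k : j ≢ k) (j≢m : j ≢ m) (k≢m : k ≢ m) where

  ijkm : Vec (Fin 5) 4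
  ijkm = i ∷ j ∷ k ∷ m ∷ []

  ijkm-unique : Unique ijkm
  ijkm-unique = (i≢j ∷ i≢k ∷ i≢m ∷ []) ∷ (j≢k ∷ j≢m ∷ []) ∷ (k≢m ∷ []) ∷ [] ∷ []

  σ : Fin 5 → Fin 5
  σ = transpose i j ∘ transpose k m

  σi≡j : σ i ≡ j
  σi≡j = trans (cong (transpose i j) (transpose-mismatch i≢k i≢m)) (transpose-matchˡ i j)

  σj≡i : σ j ≡ i
  σj≡i = trans (cong (transpose i j) (transpose-mismatch j≢k j≢m)) (transpose-matchʳ i j)

  σk≡m : σ k ≡ m
  σk≡m = trans (cong (transpose i j) (transpose-matchˡ k m)) (transpose-mismatch (i≢m ∘ sym) (j≢m ∘ sym))

  σm≡k : σ m ≡ k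
  σm≡k = trans (cong (transpose i j) (transpose-matchʳ k m)) (transpose-mismatch (i≢k ∘ sym) (j≢k ∘ sym))

  σ-∉ : ∀ {x} → x ∉ ijkm → σ x ≡ x
  σ-∉ x∉ijkm =
    trans (cong (transpose i j) (transpose-mismatch (x∉ijkm ∘ there ∘ there ∘ here)
                                                    (x∉ijkm ∘ there ∘ there ∘ there ∘ here)))
          (transpose-mismatch (x∉ijkm ∘ here) (x∉ijkm ∘ there ∘ here))

  σ-involutive : ∀ x → σ (σ x) ≡ x
  σ-involutive x with x ∈? ijkm
  ... | yes (here refl)                         = trans (cong σ σi≡j) σj≡i
  ... | yes (there (here refl))                 = trans (cong σ σj≡i) σi≡j
  ... | yes (there (there (here refl)))         = trans (cong σ σk≡m) σm≡k
  ... | yes (there (there (there (here refl)))) = trans (cong σ σm≡k) σk≡m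
  ... | no  x∉ijkm                              = trans (cong σ (σ-∉ x∉ijkm)) (σ-∉ x∉ijkm)

  σ-injective : Injective _≡_ _≡_ σ
  σ-injective {x} {y} σx≡σy = trans (sym (σ-involutive x)) (trans (cong σ σx≡σy) (σ-involutive y))

  σ-orbit : ∀ {a b} → σ b ≡ a → a ≡ b ⊎ SameCube a b i j ⊎ SameCube a b k m
  σ-orbit {b = b} σb≡a with b ∈? ijkm
  ... | yes (here refl)                         = inj₂ (inj₁ (inj₂ (trans (sym σb≡a) σi≡j , refl)))
  ... | yes (there (here refl))                 = inj₂ (inj₁ (inj₁ (trans (sym σb≡a) σj≡i , refl)))
  ... | yes (there (there (here refl)))         = inj₂ (inj₂ (inj₂ (trans (sym σb≡a) σk≡m , refl)))
  ... | yes (there (there (there (here refl)))) = inj₂ (inj₂ (inj₁ (trans (sym σb≡a) σm≡k , refl)))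
  ... | no  b∉ijkm                              = inj₁ (trans (sym σb≡a) (σ-∉ b∉ijkm))

  σ-fixed-unique : ∀ {a b} → σ a ≡ a → σ b ≡ b → a ≡ b
  σ-fixed-unique σa≡a σb≡b = ∉-unique ijkm-unique (fixed⇒∉ σa≡a) (fixed⇒∉ σb≡b)
    where
    fixed⇒∉ : ∀ {x} → σ x ≡ x → x ∉ ijkm
    fixed⇒∉ σi≡i (here refl)                         = i≢j (trans (sym σi≡i) σi≡j)
    fixed⇒∉ σj≡j (there (here refl))                 = i≢j (trans (sym σj≡i) σj≡j)
    fixed⇒∉ σk≡k (there (there (here refl)))         = k≢m (trans (sym σk≡k) σk≡m)
    fixed⇒∉ σm≡m (there (there (there (here refl)))) = k≢m (trans (sym σm≡k) σm≡m)

stacked : (Fin 2 → Fin 5 → Fin 5) → (Fin 5 → Fin 5) → Parallelepiped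
stacked L σ 0F r x = L r x
stacked L σ 1F r x = L (flip r) (σ x)

row-injective : ∀ {P} → IsLayerLatin P → ∀ l r → Injective _≡_ _≡_ (P l r)
row-injective (rows-distinct , _) l r {x} {y} eq =
  decidable-stable (x ≟ y) (λ x≢y → rows-distinct l r x y x≢y eq)

noTransversals⇒layer₁ˡ : ∀ {P x y} → NoTransversals P x y → ∀ r → P 1F r x ≡ P 0F (flip r) y
noTransversals⇒layer₁ˡ nt r = decidable-stable (_ ≟ _) (nt 1F r)

noTransversals⇒layer₁ʳ : ∀ {P x y} → NoTransversals P x y → ∀ r → P 1F r y ≡ P 0F (flip r) x
noTransversals⇒layer₁ʳ nt 0F = sym (decidable-stable (_ ≟ _) (nt 0F 1F))
noTransversals⇒layer₁ʳ nt 1F = sym (decidable-stable (_ ≟ _) (nt 0F 0F))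

module TwoCubesWithoutTransversals {P : Parallelepiped} (latin : IsLayerLatin P) {i j k m : Fin 5}
  (i≢j : i ≢ j) (i≢k : i ≢ k) (i≢m : i ≢ m) (j≢k : j ≢ k) (j≢m : j ≢ m) (k≢m : k ≢ m)
  (nt₁ : NoTransversals P i j) (nt₂ : NoTransversals P k m) where

  open DoubleTransposition i≢j i≢k i≢m j≢k j≢m k≢m public

  layer₁-on-ijkm : ∀ r {x} → x ∈ ijkm → P 1F r x ≡ P 0F (flip r) (σ x)
  layer₁-on-ijkm r (here refl) =
    trans (noTransversals⇒layer₁ˡ {P} nt₁ r) (cong (P 0F (flip r)) (sym σi≡j))
  layer₁-on-ijkm r (there (here refl)) =
    trans (noTransversals⇒layer₁ʳ {P} nt₁ r) (cong (P 0F (flip r)) (sym σj≡i))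
  layer₁-on-ijkm r (there (there (here refl))) =
    trans (noTransversals⇒layer₁ˡ {P} nt₂ r) (cong (P 0F (flip r)) (sym σk≡m))
  layer₁-on-ijkm r (there (there (there (here refl)))) =
    trans (noTransversals⇒layer₁ʳ {P} nt₂ r) (cong (P 0F (flip r)) (sym σm≡k))

  layer₁ : ∀ r x → P 1F r x ≡ P 0F (flip r) (σ x)
  layer₁ r x with x ∈? ijkm
  ... | yes x∈ijkm = layer₁-on-ijkm r x∈ijkm
  ... | no  x∉ijkm = image⊆⇒agree-outside {g = P 0F (flip r) ∘ σ}
    (row-injective latin 1F r) (σ-injective ∘ row-injective latin 0F (flip r)) ijkm-unique x∉ijkm
    (λ y∈ijkm → subst (_∈ map (P 0F (flip r) ∘ σ) ijkm) (sym (layer₁-on-ijkm r y∈ijkm))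
                      (∈-map⁺ (P 0F (flip r) ∘ σ) y∈ijkm))

  P≗stacked : ∀ l r x → P l r x ≡ stacked (P 0F) σ l r x
  P≗stacked 0F r x = refl
  P≗stacked 1F r x = layer₁ r x

SameSet-sym : ∀ {x y z w} → SameSet x y z w → SameSet z w x y
SameSet-sym (inj₁ (x≡z , y≡w)) = inj₁ (sym x≡z , sym y≡w)
SameSet-sym (inj₂ (x≡w , y≡z)) = inj₂ (sym y≡z , sym x≡w)

SameSet-cong : ∀ {x y z w x′ y′ z′ w′} → x ≡ x′ → y ≡ y′ → z ≡ z′ → w ≡ w′ →
               SameSet x y z w → SameSet x′ y′ z′ w′
SameSet-cong refl refl refl refl s = s

sameSet? : ∀ x y z w → Dec (SameSet x y z w)
sameSet? x y z w = (x ≟ z ×-dec y ≟ w) ⊎-dec (x ≟ w ×-dec y ≟ z)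

sameSet-crossˡ : ∀ {x y z w} → x ≢ z → SameSet x y z w → x ≡ w
sameSet-crossˡ x≢z (inj₁ (x≡z , _)) = contradiction x≡z x≢z
sameSet-crossˡ _   (inj₂ (x≡w , _)) = x≡w

sameSet-crossʳ : ∀ {x y z w} → y ≢ w → SameSet x y z w → y ≡ z
sameSet-crossʳ y≢w (inj₁ (_ , y≡w)) = contradiction y≡w y≢w
sameSet-crossʳ _   (inj₂ (_ , y≡z)) = y≡z

sameSet⇒⊆ : ∀ {x y z w v} → SameSet x y z w → v ∈ x ∷ y ∷ [] → v ∈ z ∷ w ∷ []
sameSet⇒⊆ (inj₁ (refl , refl)) v∈xy               = v∈xy
sameSet⇒⊆ (inj₂ (refl , refl)) (here v≡x)         = there (here v≡x)
sameSet⇒⊆ (inj₂ (refl , refl)) (there (here v≡y)) = here v≡y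

SamePairOfSets : (x y x′ y′ z w z′ w′ : Fin 5) → Set
SamePairOfSets x y x′ y′ z w z′ w′ =
  (SameSet x y z w × SameSet x′ y′ z′ w′) ⊎ (SameSet x y z′ w′ × SameSet x′ y′ z w)

samePairOfSets⇒⊆ : ∀ {x y x′ y′ z w z′ w′ v} → SamePairOfSets x y x′ y′ z w z′ w′ →
                   v ∈ x ∷ y ∷ x′ ∷ y′ ∷ [] → v ∈ z ∷ w ∷ z′ ∷ w′ ∷ []
samePairOfSets⇒⊆ {x} {y} {z = z} {w} paired v∈ with paired | ++⁻ (x ∷ y ∷ []) v∈
... | inj₁ (s , _) | inj₁ v∈xy   = ∈-++⁺ˡ (sameSet⇒⊆ s v∈xy)
... | inj₁ (_ , s) | inj₂ v∈x′y′ = ∈-++⁺ʳ (z ∷ w ∷ []) (sameSet⇒⊆ s v∈x′y′)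
... | inj₂ (s , _) | inj₁ v∈xy   = ∈-++⁺ʳ (z ∷ w ∷ []) (sameSet⇒⊆ s v∈xy)
... | inj₂ (_ , s) | inj₂ v∈x′y′ = ∈-++⁺ˡ (sameSet⇒⊆ s v∈x′y′)

images-distinct : ∀ {h : Fin 5 → Fin 5} → Injective _≡_ _≡_ h →
  ∀ {a b a′ b′} → a ≢ b → ¬ (a ≡ a′ × b ≡ b′) → ¬ SameSet (h a) (h b′) (h a′) (h b)
images-distinct h-inj _   ¬fixed (inj₁ (ha≡ha′ , hb′≡hb)) = ¬fixed (h-inj ha≡ha′ , sym (h-inj hb′≡hb))
images-distinct h-inj a≢b _      (inj₂ (ha≡hb , _))      = a≢b (h-inj ha≡hb)

module _ {f g : Fin 5 → Fin 5} (f-inj : Injective _≡_ _≡_ f) (g-inj : Injective _≡_ _≡_ g)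
         (f≢g : ∀ x → f x ≢ g x) where

  fixedˡ-paired⇒fixedʳ : ∀ {a b b′} →
    SamePairOfSets (f a) (f b′) (f a) (f b) (g a) (g b′) (g a) (g b) → b ≡ b′
  fixedˡ-paired⇒fixedʳ {a} (inj₁ (s , s′)) =
    g-inj (trans (sym (sameSet-crossˡ (f≢g a) s′)) (sameSet-crossˡ (f≢g a) s))
  fixedˡ-paired⇒fixedʳ {a} (inj₂ (s , s′)) =
    g-inj (trans (sym (sameSet-crossˡ (f≢g a) s)) (sameSet-crossˡ (f≢g a) s′))

  fixedʳ-paired⇒fixedˡ : ∀ {a a′ b} →
    SamePairOfSets (f a) (f b) (f a′) (f b) (g a) (g b) (g a′) (g b) → a ≡ a′
  fixedʳ-paired⇒fixedˡ {b = b} (inj₁ (s , s′)) =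
    g-inj (trans (sym (sameSet-crossʳ (f≢g b) s)) (sameSet-crossʳ (f≢g b) s′))
  fixedʳ-paired⇒fixedˡ {b = b} (inj₂ (s , s′)) =
    g-inj (trans (sym (sameSet-crossʳ (f≢g b) s′)) (sameSet-crossʳ (f≢g b) s))

  ranges-unpaired : ∀ {a b a′ b′} → a ≢ b → a ≢ b′ → a′ ≢ b → a′ ≢ b′ → ¬ (a ≡ a′ × b ≡ b′) →
    ¬ SamePairOfSets (f a) (f b′) (f a′) (f b) (g a) (g b′) (g a′) (g b)
  ranges-unpaired {a} {b} {a′} {b′} a≢b a≢b′ a′≢b a′≢b′ ¬fixed paired with a ≟ a′ | b ≟ b′
  ... | yes refl | _        = ¬fixed (refl , fixedˡ-paired⇒fixedʳ paired)
  ... | _        | yes refl = ¬fixed (fixedʳ-paired⇒fixedˡ paired , refl)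
  ... | no a≢a′  | no b≢b′  =
    let (w , w∉U) = ∃-∉ U
    in  f≢g w (image⊆⇒agree-outside f-inj g-inj U-unique w∉U
                 (λ x∈U → samePairOfSets⇒⊆ paired (∈-map⁺ f x∈U)))
    where
    U : Vec (Fin 5) 4
    U = a ∷ b′ ∷ a′ ∷ b ∷ []

    U-unique : Unique U
    U-unique = (a≢b′ ∷ a≢a′ ∷ a≢b ∷ []) ∷ (a′≢b′ ∘ sym ∷ b≢b′ ∘ sym ∷ []) ∷ (a′≢b ∷ []) ∷ [] ∷ []

RangesPaired : Parallelepiped → Fin 5 → Fin 5 → Set
RangesPaired P a b =
  SamePairOfSets (d₁ 0F 0F) (d₂ 0F 0F) (d₁ 1F 1F) (d₂ 1F 1F) (d₁ 0F 1F) (d₂ 0F 1F) (d₁ 1F 0F) (d₂ 1F 0F)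
  where
  d₁ d₂ : Fin 2 → Fin 2 → Fin 5
  d₁ = diag₁ P a b
  d₂ = diag₂ P a b

-- With the ranges of (0,0), (1,1) distinct and those of (0,1), (1,0) distinct, fewer than
-- three ranges would pair each of (0,0), (1,1) with a different one of (0,1), (1,0).
atLeastThreeRanges : ∀ {P a b} → (∀ l r → IsTransversal P a b l r) →
  ¬ SameRange P a b 0F 0F 1F 1F → ¬ SameRange P a b 0F 1F 1F 0F → ¬ RangesPaired P a b →
  AtLeastThreeRanges P a b
atLeastThreeRanges {P} {a} {b} t ¬00~11 ¬01~10 ¬paired
  with sameSet? (diag₁ P a b 0F 0F) (diag₂ P a b 0F 0F) (diag₁ P a b 0F 1F) (diag₂ P a b 0F 1F)
     | sameSet? (diag₁ P a b 0F 0F) (diag₂ P a b 0F 0F) (diag₁ P a b 1F 0F) (diag₂ P a b 1F 0F)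
... | no ¬00~01 | no ¬00~10 =
  0F , 0F , 0F , 1F , 1F , 0F , t 0F 0F , t 0F 1F , t 1F 0F , ¬00~01 , ¬00~10 , ¬01~10
... | no ¬00~01 | yes 00~10 =
  0F , 0F , 0F , 1F , 1F , 1F , t 0F 0F , t 0F 1F , t 1F 1F , ¬00~01 , ¬00~11 ,
  λ 01~11 → ¬paired (inj₂ (00~10 , SameSet-sym 01~11))
... | yes 00~01 | no ¬00~10 =
  0F , 0F , 1F , 0F , 1F , 1F , t 0F 0F , t 1F 0F , t 1F 1F , ¬00~10 , ¬00~11 ,
  λ 10~11 → ¬paired (inj₁ (00~01 , SameSet-sym 10~11))
... | yes 00~01 | yes 00~10 =
  0F , 1F , 1F , 0F , 1F , 1F , t 0F 1F , t 1F 0F , t 1F 1F , ¬01~10 ,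
  (λ 01~11 → ¬paired (inj₂ (00~10 , SameSet-sym 01~11))) ,
  (λ 10~11 → ¬paired (inj₁ (00~01 , SameSet-sym 10~11)))

stacked-atLeastThreeRanges : ∀ {L : Fin 2 → Fin 5 → Fin 5} {σ : Fin 5 → Fin 5} →
  (∀ r → Injective _≡_ _≡_ (L r)) → (∀ x → L 0F x ≢ L 1F x) →
  ∀ {a b} → a ≢ b → a ≢ σ b → σ a ≢ b → σ a ≢ σ b → ¬ (a ≡ σ a × b ≡ σ b) →
  AtLeastThreeRanges (stacked L σ) a b
stacked-atLeastThreeRanges {L} {σ} L-inj L-col {a} {b} a≢b a≢σb σa≢b σa≢σb ¬fixed =
  atLeastThreeRanges {stacked L σ} transversal
    (images-distinct (L-inj 0F) a≢b ¬fixed)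
    (images-distinct (L-inj 1F) a≢b ¬fixed)
    (ranges-unpaired (L-inj 0F) (L-inj 1F) L-col a≢b a≢σb σa≢b σa≢σb ¬fixed)
  where
  transversal : ∀ l r → IsTransversal (stacked L σ) a b l r
  transversal 0F 0F = a≢σb ∘ L-inj 0F
  transversal 0F 1F = a≢σb ∘ L-inj 1F
  transversal 1F 0F = σa≢b ∘ L-inj 1F
  transversal 1F 1F = σa≢b ∘ L-inj 0F

AtLeastThreeRanges-resp : ∀ {P Q a b} → (∀ l r x → P l r x ≡ Q l r x) →
  AtLeastThreeRanges Q a b → AtLeastThreeRanges P a b
AtLeastThreeRanges-resp {P} {Q} {a} {b} P≗Q
  (l₁ , r₁ , l₂ , r₂ , l₃ , r₃ , t₁ , t₂ , t₃ , ¬s₁₂ , ¬s₁₃ , ¬s₂₃) =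
  l₁ , r₁ , l₂ , r₂ , l₃ , r₃ , transversal t₁ , transversal t₂ , transversal t₃ ,
  ¬s₁₂ ∘ sameRange , ¬s₁₃ ∘ sameRange , ¬s₂₃ ∘ sameRange
  where
  transversal : ∀ {l r} → IsTransversal Q a b l r → IsTransversal P a b l r
  transversal t e = t (trans (sym (P≗Q _ _ a)) (trans e (P≗Q _ _ b)))

  sameRange : ∀ {l r l′ r′} → SameRange P a b l r l′ r′ → SameRange Q a b l r l′ r′
  sameRange = SameSet-cong (P≗Q _ _ a) (P≗Q _ _ b) (P≗Q _ _ a) (P≗Q _ _ b)

proposition10 : (P : Parallelepiped) → IsLayerLatin P →
    (i j k m : Fin 5) → i ≢ j → k ≢ m → Nonadjacent i j k m →
    NoTransversals P i j → NoTransversals P k m →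
    (a b : Fin 5) → a ≢ b → ¬ SameCube a b i j → ¬ SameCube a b k m →
    AtLeastThreeRanges P a b
proposition10 P latin i j k m i≢j k≢m (i≢k , i≢m , j≢k , j≢m) nt₁ nt₂ a b a≢b ¬ab~ij ¬ab~km =
  AtLeastThreeRanges-resp P≗stacked
    (stacked-atLeastThreeRanges (row-injective latin 0F) (proj₂ latin 0F)
                                a≢b a≢σb σa≢b (a≢b ∘ σ-injective) ¬both-fixed)
  where
  open TwoCubesWithoutTransversals latin i≢j i≢k i≢m j≢k j≢m k≢m nt₁ nt₂

  a≢σb : a ≢ σ b
  a≢σb = [ a≢b , [ ¬ab~ij , ¬ab~km ] ] ∘ σ-orbit ∘ sym

  σa≢b : σ a ≢ b
  σa≢b σa≡b = a≢σb (trans (sym (σ-involutive a)) (cong σ σa≡b))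

  ¬both-fixed : ¬ (a ≡ σ a × b ≡ σ b)
  ¬both-fixed (a≡σa , b≡σb) = a≢b (σ-fixed-unique (sym a≡σa) (sym b≡σb))
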